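{- Let $k,s\ge0$ and let $\mathfrak{U}_1,\mathfrak{U}_2$ be ordered-data sets over a finite alphabet $\Gamma$ with $\mathcal{V}^{k2^s}_\Gamma(\mathfrak{U}_1)=\mathcal{V}^{k2^s}_\Gamma(\mathfrak{U}_2)$. Then for every $\mathrm{MSO}(\sim,\prec,\prec_{suc})$ sentence $\varphi$ with $\mathrm{MSO\text{ - }qr}(\varphi)\le s$ and $\mathrm{FO\text{ - }qr}(\varphi)\le k$, we have $\mathfrak{U}_1\models\varphi$ if and only if $\mathfrak{U}_2\models\varphi$.
   Context: An ordered-data set over $\Gamma$ is a finite set $U$ whose elements $u$ carry a label $\mathrm{lab}(u)\in\Gamma$ and a data value $\mathrm{val}(u)\in\mathbb{N}$, viewed as a structure with unary label predicates, $u\sim v$ iff equal data values, $u\prec v$ iff $\mathrm{val}(u)<\mathrm{val}(v)$, and $u\prec_{suc}v$ iff $\mathrm{val}(v)$ is the least data value occurring in the set greater than $\mathrm{val}(u)$. A $k$-characteristic function on $\Gamma$ is $f:\Gamma\to\{0,1,\dots,k\}$; it is a $k$-characteristic function for $S\subseteq\Gamma$ if $f(a)\in\{1,\dots,k\}$ for $a\in S$ and $f(a)=0$ for $a\notin S$. For $T\subseteq\Gamma$ let $V(T)$-notation be: $V(a)$ is the set of data values of $a$-elements, $[S]=\bigcap_{a\in S}V(a)\cap\bigcap_{b\notin S}\overline{V(b)}$. If $d_1<\dots<d_m$ are the data values occurring in $\mathfrak{U}$, the $k$-extended representation $\mathcal{V}^k_\Gamma(\mathfrak{U})$ is the word $(S_1,f_1)\cdots(S_m,f_m)$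 where $d_i\in[S_i]$, $f_i$ is a $k$-characteristic function for $S_i$, and for each $a\in\Gamma$: if $1\le f_i(a)\le k-1$ there are exactly $f_i(a)$ $a$-elements with data value $d_i$, and if $f_i(a)=k$ there are at least $k$ $a$-elements with data value $d_i$. Sentences of $\mathrm{MSO}(\sim,\prec,\prec_{suc})$ are assumed in the form $Q_1X_1\cdots Q_sX_s\,\psi$ with $Q_i\in\{\exists,\forall\}$, $X_i$ monadic second-order variables, and $\psi$ first-order over $\sim,\prec,\prec_{suc}$, label predicates and $X_1,\dots,X_s$; $\mathrm{MSO\text{ - }qr}(\varphi)=s$ and $\mathrm{FO\text{ - }qr}(\varphi)$ is the quantifier rank of $\psi$. -}

module Defs where

open import Data.Nat using (ℕ; zero; suc; _+_; _<_; _≤_; _⊔_)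
open import Data.Fin using (Fin; toℕ)
open import Data.Fin.Subset using (Subset; _∈_; _∉_)
open import Data.Vec using (Vec; lookup)
open import Data.List using (List; length; filter; allFin)
open import Data.Bool using (Bool; true; false)
open import Data.Product using (Σ; ∃; _×_; _,_)
open import Data.Sum using (_⊎_)
open import Relation.Nullary using (¬_)
open import Relation.Nullary.Decidable using (_×-dec_)
open import Relation.Binary.PropositionalEquality using (_≡_; _≢_)
open import Function.Bundles using (_⇔_)
import Data.Fin as F
import Data.Nat as N

record ODS (g : ℕ) : Set where
  field
    size : ℕ
    lab  : Fin size → Fin g
    val  : Fin size → ℕ
open ODS public

module _ {g : ℕ} (U : ODS g) where
  Elem : Set
  Elem = Fin (size U)

  Sim : Elem → Elem → Set
  Sim u v = val U u ≡ val U v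

  Prec : Elem → Elem → Set
  Prec u v = val U u < val U v

  Succ : Elem → Elem → Set
  Succ u v = (val U u < val U v) × (∀ w → val U u < val U w → val U v ≤ val U w)

  countLV : Fin g → ℕ → ℕ
  countLV a d = length (filter (λ u → (lab U u F.≟ a) ×-dec (val U u N.≟ d)) (allFin (size U)))

Letter : ℕ → ℕ → Set
Letter g k = Subset g × Vec (Fin (suc k)) g

IsCharFun : ∀ {g} k → Subset g → Vec (Fin (suc k)) g → Set
IsCharFun {g} k S f = ∀ (a : Fin g) →
  ((a ∈ S → (1 ≤ toℕ (lookup f a)) × (toℕ (lookup f a) ≤ k)) × (a ∉ S → toℕ (lookup f a) ≡ 0))

IsRep : ∀ {g} (k : ℕ) (U : ODS g) → List (Letter g k) → Set
IsRep {g} k U w =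
  Σ (Fin (length w) → ℕ) λ d →
    (∀ i j → F._<_ i j → d i < d j)
    × (∀ i → ∃ λ u → val U u ≡ d i)
    × (∀ u → ∃ λ i → val U u ≡ d i)
    × (∀ i → let S = Data.Product.proj₁ (Data.List.lookup w i)
                 f = Data.Product.proj₂ (Data.List.lookup w i) in
         (∀ a → (a ∈ S ⇔ (∃ λ u → (lab U u ≡ a) × (val U u ≡ d i))))
         × IsCharFun k S f
         × (∀ a → 1 ≤ toℕ (lookup f a) → suc (toℕ (lookup f a)) ≤ k →
                 countLV U a (d i) ≡ toℕ (lookup f a))
         × (∀ a → toℕ (lookup f a) ≡ k → k ≤ countLV U a (d i)))
  where import Data.Product; import Data.List

-- MSO(∼,≺,≺suc) syntax in the normal form Q₁X₁⋯QₛXₛ ψ.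
-- Fo g m n : first-order formulas over Γ = Fin g with m monadic
-- second-order variables and n first-order variables (de Bruijn).

data Fo (g m : ℕ) : ℕ → Set where
  lbl  : ∀ {n} → Fin g → Fin n → Fo g m n
  eq   : ∀ {n} → Fin n → Fin n → Fo g m n
  sim  : ∀ {n} → Fin n → Fin n → Fo g m n
  prec : ∀ {n} → Fin n → Fin n → Fo g m n
  succ : ∀ {n} → Fin n → Fin n → Fo g m n
  mem  : ∀ {n} → Fin n → Fin m → Fo g m n
  neg  : ∀ {n} → Fo g m n → Fo g m n
  and  : ∀ {n} → Fo g m n → Fo g m n → Fo g m n
  or   : ∀ {n} → Fo g m n → Fo g m n → Fo g m n
  ex   : ∀ {n} → Fo g m (suc n) → Fo g m n
  all  : ∀ {n} → Fo g m (suc n) → Fo g m n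

qr : ∀ {g m n} → Fo g m n → ℕ
qr (lbl _ _)  = 0
qr (eq _ _)   = 0
qr (sim _ _)  = 0
qr (prec _ _) = 0
qr (succ _ _) = 0
qr (mem _ _)  = 0
qr (neg φ)    = qr φ
qr (and φ ψ)  = qr φ ⊔ qr ψ
qr (or φ ψ)   = qr φ ⊔ qr ψ
qr (ex φ)     = suc (qr φ)
qr (all φ)    = suc (qr φ)

data MSO (g : ℕ) : ℕ → Set where
  body  : ∀ {m} → Fo g m 0 → MSO g m
  exSO  : ∀ {m} → MSO g (suc m) → MSO g m
  allSO : ∀ {m} → MSO g (suc m) → MSO g m

Sentence : ℕ → Set
Sentence g = MSO g 0

MSO-qr : ∀ {g m} → MSO g m → ℕ
MSO-qr (body _)  = 0
MSO-qr (exSO φ)  = suc (MSO-qr φ)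
MSO-qr (allSO φ) = suc (MSO-qr φ)

FO-qr : ∀ {g m} → MSO g m → ℕ
FO-qr (body ψ)  = qr ψ
FO-qr (exSO φ)  = FO-qr φ
FO-qr (allSO φ) = FO-qr φ

_∷ᵉ_ : ∀ {A : Set} {n} → A → (Fin n → A) → Fin (suc n) → A
(x ∷ᵉ ρ) F.zero    = x
(x ∷ᵉ ρ) (F.suc i) = ρ i

module _ {g : ℕ} (U : ODS g) where
  SatFo : ∀ {m n} → (Fin m → (Elem U → Bool)) → (Fin n → Elem U) → Fo g m n → Set
  SatFo σ ρ (lbl a x)  = lab U (ρ x) ≡ a
  SatFo σ ρ (eq x y)   = ρ x ≡ ρ y
  SatFo σ ρ (sim x y)  = Sim U (ρ x) (ρ y)
  SatFo σ ρ (prec x y) = Prec U (ρ x) (ρ y)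
  SatFo σ ρ (succ x y) = Succ U (ρ x) (ρ y)
  SatFo σ ρ (mem x X)  = σ X (ρ x) ≡ true
  SatFo σ ρ (neg φ)    = ¬ SatFo σ ρ φ
  SatFo σ ρ (and φ ψ)  = SatFo σ ρ φ × SatFo σ ρ ψ
  SatFo σ ρ (or φ ψ)   = SatFo σ ρ φ ⊎ SatFo σ ρ ψ
  SatFo σ ρ (ex φ)     = ∃ λ u → SatFo σ (u ∷ᵉ ρ) φ
  SatFo σ ρ (all φ)    = ∀ u → SatFo σ (u ∷ᵉ ρ) φ

  SatMSO : ∀ {m} → (Fin m → (Elem U → Bool)) → MSO g m → Set
  SatMSO σ (body ψ)  = SatFo σ (λ ()) ψ
  SatMSO σ (exSO φ)  = ∃ λ (X : Elem U → Bool) → SatMSO (X ∷ᵉ σ) φ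
  SatMSO σ (allSO φ) = ∀ (X : Elem U → Bool) → SatMSO (X ∷ᵉ σ) φ

_⊨_ : ∀ {g} → ODS g → Sentence g → Set
U ⊨ φ = SatMSO U (λ ()) φ

-- Attach to every element its profile: the rank of its data value among the data
-- values of the structure, its label, and one bit for each chosen set and each chosen
-- point telling whether the element lies in that set or is that point. Two expanded
-- structures are T-similar when, for every profile, the numbers of elements carrying
-- it are equal or both at least T. Atomic formulas only look at the profiles of the
-- chosen points, because ∼, ≺ and ≺suc are determined by ranks. A point choice can be
-- answered at the cost of one unit of threshold (an element of the same profile
-- exists, and every count drops by at most one), a set choice at the cost of halving
-- it (every profile class is split in two, and a split of a count known up to 2T can
-- be mirrored up to T). A common k2^s-extended representation makes the structures
-- k2^s-similar, which leaves threshold at least k after the s set quantifiers.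

module Submission where

open import Defs
open import Data.Bool using (Bool; true; false; _∧_; not; if_then_else_)
import Data.Bool as Bool
open import Data.Bool.Properties using (∧-zeroʳ; ∧-identityʳ)
open import Data.Fin using (Fin; zero; suc; toℕ; fromℕ<)
import Data.Fin as F
open import Data.Fin.Properties using (toℕ-injective; toℕ<n; toℕ-fromℕ<)
open import Data.List using (List; length; filter; tabulate)
import Data.List as List
import Data.Vec as Vec
open import Data.Nat using (ℕ; zero; suc; _+_; _∸_; _*_; _^_; _≤_; _<_; z≤n; s≤s; s≤s⁻¹; _≤?_)
import Data.Nat as N
open import Data.Nat.Properties
open import Data.Product using (∃; _×_; _,_; proj₁; proj₂; uncurry)
open import Data.Product.Properties using (≡-dec; ,-injective)
open import Data.Sum using (_⊎_; inj₁; inj₂)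
open import Function using (_∘_; id; _⇔_; mk⇔; Equivalence)
open import Relation.Binary.Definitions using (DecidableEquality)
open import Relation.Binary.PropositionalEquality
open import Relation.Nullary using (Dec; yes; no; does; _×-dec_)
open import Relation.Nullary.Decidable using (does-⇔; dec-true; dec-false)

open Equivalence using (to; from)

count : ∀ {N} → (Fin N → Bool) → ℕ
count {zero}  P = 0
count {suc N} P = (if P zero then 1 else 0) + count (P ∘ suc)

count-cong : ∀ {N} {P Q : Fin N → Bool} → P ≗ Q → count P ≡ count Q
count-cong {zero}  P≗Q = refl
count-cong {suc N} P≗Q =
  cong₂ _+_ (cong (λ b → if b then 1 else 0) (P≗Q zero)) (count-cong (P≗Q ∘ suc))

count-none : ∀ {N} {P : Fin N → Bool} → (∀ u → P u ≡ false) → count P ≡ 0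
count-none {zero}      none = refl
count-none {suc N} {P} none rewrite none zero = count-none (none ∘ suc)

count-split : ∀ {N} (P Q : Fin N → Bool) →
  count (λ u → P u ∧ Q u) + count (λ u → P u ∧ not (Q u)) ≡ count P
count-split {zero}  P Q = refl
count-split {suc N} P Q with P zero | Q zero | count-split (P ∘ suc) (Q ∘ suc)
... | true  | true  | ih = cong suc ih
... | true  | false | ih = trans (+-suc _ _) (cong suc ih)
... | false | _     | ih = ih

count-∧-≤ : ∀ {N} (P Q : Fin N → Bool) → count (λ u → P u ∧ Q u) ≤ count P
count-∧-≤ P Q = subst (count (λ u → P u ∧ Q u) ≤_) (count-split P Q) (m≤m+n _ _)

count-∧-not : ∀ {N} (P Q : Fin N → Bool) →
  count (λ u → P u ∧ not (Q u)) ≡ count P ∸ count (λ u → P u ∧ Q u)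
count-∧-not P Q = trans (sym (m+n∸m≡n both _)) (cong (_∸ both) (count-split P Q))
  where both = count (λ u → P u ∧ Q u)

count-pos : ∀ {N} (P : Fin N → Bool) {v} → P v ≡ true → 1 ≤ count P
count-pos P {zero}  Pv rewrite Pv = s≤s z≤n
count-pos P {suc v} Pv = ≤-trans (count-pos (P ∘ suc) Pv) (m≤n+m _ _)

count-witness : ∀ {N} (P : Fin N → Bool) → 1 ≤ count P → ∃ λ v → P v ≡ true
count-witness {suc N} P pos with P zero in P0
... | true  = zero , P0
... | false = let v , Pv = count-witness (P ∘ suc) pos in suc v , Pv

dec-true⁻¹ : ∀ {A : Set} (a? : Dec A) → does a? ≡ true → A
dec-true⁻¹ (yes a) _ = a

⁅_⁆ : ∀ {N} → Fin N → Fin N → Bool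
⁅ v ⁆ u = does (v F.≟ u)

⁅⁆-sym : ∀ {N} (u v : Fin N) → ⁅ u ⁆ v ≡ ⁅ v ⁆ u
⁅⁆-sym u v = does-⇔ (mk⇔ sym sym) (u F.≟ v) (v F.≟ u)

count-singleton : ∀ {N} (P : Fin N → Bool) v →
  count (λ u → P u ∧ ⁅ v ⁆ u) ≡ (if P v then 1 else 0)
count-singleton {suc N} P zero
  rewrite ∧-identityʳ (P zero) | count-none {P = λ u → P (suc u) ∧ false} (∧-zeroʳ ∘ P ∘ suc)
  = +-identityʳ _
count-singleton {suc N} P (suc v) rewrite ∧-zeroʳ (P zero) = count-singleton (P ∘ suc) v

count-subset : ∀ {N} (P : Fin N → Bool) {x} → x ≤ count P →
  ∃ λ (Y : Fin N → Bool) → count (λ u → P u ∧ Y u) ≡ x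
count-subset {zero}  P x≤ = (λ ()) , sym (n≤0⇒n≡0 x≤)
count-subset {suc N} P {x} x≤ with P zero | x
... | false | _     = let Y , counted = count-subset (P ∘ suc) x≤ in (false ∷ᵉ Y) , counted
... | true  | zero  = let Y , counted = count-subset (P ∘ suc) z≤n in (false ∷ᵉ Y) , counted
... | true  | suc x = let Y , counted = count-subset (P ∘ suc) (s≤s⁻¹ x≤) in (true ∷ᵉ Y) , cong suc counted

infix 4 _≈[_]_

_≈[_]_ : ℕ → ℕ → ℕ → Set
x ≈[ T ] y = x ≡ y ⊎ (T ≤ x × T ≤ y)

≈-sym : ∀ {T x y} → x ≈[ T ] y → y ≈[ T ] x
≈-sym (inj₁ x≡y)         = inj₁ (sym x≡y)
≈-sym (inj₂ (T≤x , T≤y)) = inj₂ (T≤y , T≤x)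

≈-trans : ∀ {T x y z} → x ≈[ T ] y → y ≈[ T ] z → x ≈[ T ] z
≈-trans (inj₁ refl)        y≈z                = y≈z
≈-trans x≈y                (inj₁ refl)        = x≈y
≈-trans (inj₂ (T≤x , _))   (inj₂ (_ , T≤z))   = inj₂ (T≤x , T≤z)

≈-mono : ∀ {T T′ x y} → T′ ≤ T → x ≈[ T ] y → x ≈[ T′ ] y
≈-mono T′≤T (inj₁ x≡y)         = inj₁ x≡y
≈-mono T′≤T (inj₂ (T≤x , T≤y)) = inj₂ (≤-trans T′≤T T≤x , ≤-trans T′≤T T≤y)

≈-≤ : ∀ {T x y z} → x ≈[ T ] y → z ≤ T → z ≤ x → z ≤ y
≈-≤ (inj₁ refl)      z≤T z≤x = z≤x
≈-≤ (inj₂ (_ , T≤y)) z≤T z≤x = ≤-trans z≤T T≤y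

≈-∸ : ∀ {T x y} s → x ≈[ s + T ] y → x ∸ s ≈[ T ] y ∸ s
≈-∸ s (inj₁ x≡y)         = inj₁ (cong (_∸ s) x≡y)
≈-∸ s (inj₂ (≤x , ≤y)) = inj₂ (lower ≤x , lower ≤y)
  where
  lower : ∀ {T z} → s + T ≤ z → T ≤ z ∸ s
  lower {T} s+T≤z = subst (_≤ _) (m+n∸m≡n s T) (∸-monoˡ-≤ s s+T≤z)

m+m≤n∧o≤m⇒m≤n∸o : ∀ {m n o} → m + m ≤ n → o ≤ m → m ≤ n ∸ o
m+m≤n∧o≤m⇒m≤n∸o {m} {n} {o} m+m≤n o≤m = subst (_≤ n ∸ o) (m+n∸n≡m m m) (∸-mono m+m≤n o≤m)

-- A part of size at most T has to be copied exactly; when both parts exceed T,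
-- splitting c₂ into T and c₂ ∸ T works because c₂ ≥ T + T.
≈-split : ∀ T {c₁ c₂ x₁} → c₁ ≈[ T + T ] c₂ → x₁ ≤ c₁ →
  ∃ λ x₂ → x₂ ≤ c₂ × x₁ ≈[ T ] x₂ × c₁ ∸ x₁ ≈[ T ] c₂ ∸ x₂
≈-split T {x₁ = x₁} (inj₁ refl) x₁≤c₁ = x₁ , x₁≤c₁ , inj₁ refl , inj₁ refl
≈-split T {c₁} {c₂} {x₁} (inj₂ (≤c₁ , ≤c₂)) x₁≤c₁ with x₁ ≤? T | c₁ ∸ x₁ ≤? T
... | yes x₁≤T | _ =
  x₁ , ≤-trans x₁≤T (≤-trans (m≤m+n T T) ≤c₂) , inj₁ refl ,
  inj₂ (m+m≤n∧o≤m⇒m≤n∸o ≤c₁ x₁≤T , m+m≤n∧o≤m⇒m≤n∸o ≤c₂ x₁≤T)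
... | no x₁≰T | yes r≤T =
  c₂ ∸ (c₁ ∸ x₁) , m∸n≤m c₂ (c₁ ∸ x₁) ,
  inj₂ (<⇒≤ (≰⇒> x₁≰T) , m+m≤n∧o≤m⇒m≤n∸o ≤c₂ r≤T) ,
  inj₁ (sym (m∸[m∸n]≡n (≤-trans r≤T (≤-trans (m≤m+n T T) ≤c₂))))
... | no x₁≰T | no r≰T =
  T , ≤-trans (m≤m+n T T) ≤c₂ , inj₂ (<⇒≤ (≰⇒> x₁≰T) , ≤-refl) ,
  inj₂ (<⇒≤ (≰⇒> r≰T) , m+m≤n∧o≤m⇒m≤n∸o ≤c₂ ≤-refl)

≈-truncation : ∀ {K c n} → n ≤ K →
  (n ≡ K → K ≤ c) → (1 ≤ n → n < K → c ≡ n) → (n ≡ 0 → c ≡ 0) → c ≈[ K ] n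
≈-truncation {K} {c} {n} n≤K full exact empty with n N.≟ K
... | yes n≡K = inj₂ (full n≡K , ≤-reflexive (sym n≡K))
... | no n≢K with n
...   | zero  = inj₁ (empty refl)
...   | suc _ = inj₁ (exact (s≤s z≤n) (≤∧≢⇒< n≤K n≢K))

module Colouring {C : Set} (_≟_ : DecidableEquality C) where

  ∣_⁻¹_∣ : ∀ {N} → (Fin N → C) → C → ℕ
  ∣ τ ⁻¹ c ∣ = count (λ u → does (τ u ≟ c))

  ∣_⁻¹_∩_∣ : ∀ {N} → (Fin N → C) → C → (Fin N → Bool) → ℕ
  ∣ τ ⁻¹ c ∩ X ∣ = count (λ u → does (τ u ≟ c) ∧ X u)

  infix 4 _∼[_]_

  record _∼[_]_ {N₁ N₂} (τ₁ : Fin N₁ → C) (T : ℕ) (τ₂ : Fin N₂ → C) : Set where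
    constructor by-counts
    field
      counts : ∀ c → ∣ τ₁ ⁻¹ c ∣ ≈[ T ] ∣ τ₂ ⁻¹ c ∣
  open _∼[_]_ public

  ∼-sym : ∀ {N₁ N₂ T} {τ₁ : Fin N₁ → C} {τ₂ : Fin N₂ → C} → τ₁ ∼[ T ] τ₂ → τ₂ ∼[ T ] τ₁
  ∼-sym τ₁∼τ₂ = by-counts (≈-sym ∘ counts τ₁∼τ₂)

  realise : ∀ {N} (τ : Fin N → C) (x : C → ℕ) → (∀ c → x c ≤ ∣ τ ⁻¹ c ∣) →
    ∃ λ (X : Fin N → Bool) → ∀ c → ∣ τ ⁻¹ c ∩ X ∣ ≡ x c
  realise {N} τ x x≤ = (λ u → Y (τ u) u) , λ c → trans (count-cong (within c)) (proj₂ (sub c))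
    where
    sub : ∀ c → ∃ λ (Y : Fin N → Bool) → count (λ u → does (τ u ≟ c) ∧ Y u) ≡ x c
    sub c = count-subset (λ u → does (τ u ≟ c)) (x≤ c)
    Y : C → Fin N → Bool
    Y c = proj₁ (sub c)
    within : ∀ c u → does (τ u ≟ c) ∧ Y (τ u) u ≡ does (τ u ≟ c) ∧ Y c u
    within c u with τ u ≟ c
    ... | yes refl = refl
    ... | no _     = refl

refine-≟ : ∀ {C : Set} → DecidableEquality C → DecidableEquality (C × Bool)
refine-≟ _≟_ = ≡-dec _≟_ Bool._≟_

module Refinement {C : Set} (_≟_ : DecidableEquality C) where
  open Colouring _≟_
  module Refined = Colouring (refine-≟ _≟_)
  open Refined using () renaming (∣_⁻¹_∣ to ∣_⁻¹_∣ʳ; _∼[_]_ to _∼ʳ[_]_)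

  refine : ∀ {N} → (Fin N → C) → (Fin N → Bool) → Fin N → C × Bool
  refine τ X u = τ u , X u

  private
    refine-count : ∀ {N} (τ : Fin N → C) X c b →
      ∣ refine τ X ⁻¹ (c , b) ∣ʳ ≡ count (λ u → does (τ u ≟ c) ∧ does (X u Bool.≟ b))
    refine-count τ X c b = count-cong λ u →
      does-⇔ (mk⇔ ,-injective (uncurry (cong₂ _,_)))
             (refine-≟ _≟_ (refine τ X u) (c , b)) ((τ u ≟ c) ×-dec (X u Bool.≟ b))

  refine-count-true : ∀ {N} (τ : Fin N → C) X c → ∣ refine τ X ⁻¹ (c , true) ∣ʳ ≡ ∣ τ ⁻¹ c ∩ X ∣
  refine-count-true τ X c =
    trans (refine-count τ X c true) (count-cong λ u → cong (does (τ u ≟ c) ∧_) (is-true (X u)))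
    where
    is-true : ∀ b → does (b Bool.≟ true) ≡ b
    is-true true  = refl
    is-true false = refl

  refine-count-false : ∀ {N} (τ : Fin N → C) X c →
    ∣ refine τ X ⁻¹ (c , false) ∣ʳ ≡ ∣ τ ⁻¹ c ∣ ∸ ∣ τ ⁻¹ c ∩ X ∣
  refine-count-false τ X c =
    trans (refine-count τ X c false)
          (trans (count-cong λ u → cong (does (τ u ≟ c) ∧_) (is-false (X u)))
                 (count-∧-not (λ u → does (τ u ≟ c)) X))
    where
    is-false : ∀ b → does (b Bool.≟ false) ≡ not b
    is-false true  = refl
    is-false false = refl

  refine-∼ : ∀ {N₁ N₂ T} (τ₁ : Fin N₁ → C) (τ₂ : Fin N₂ → C) X₁ X₂ →
    (∀ c → ∣ τ₁ ⁻¹ c ∩ X₁ ∣ ≈[ T ] ∣ τ₂ ⁻¹ c ∩ X₂ ∣) →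
    (∀ c → ∣ τ₁ ⁻¹ c ∣ ∸ ∣ τ₁ ⁻¹ c ∩ X₁ ∣ ≈[ T ] ∣ τ₂ ⁻¹ c ∣ ∸ ∣ τ₂ ⁻¹ c ∩ X₂ ∣) →
    refine τ₁ X₁ ∼ʳ[ T ] refine τ₂ X₂
  refine-∼ {T = T} τ₁ τ₂ X₁ X₂ inside outside = Refined.by-counts λ where
    (c , true) →
      subst₂ _≈[ T ]_ (sym (refine-count-true τ₁ X₁ c)) (sym (refine-count-true τ₂ X₂ c)) (inside c)
    (c , false) →
      subst₂ _≈[ T ]_ (sym (refine-count-false τ₁ X₁ c)) (sym (refine-count-false τ₂ X₂ c)) (outside c)

  refine-by-point : ∀ {N₁ N₂ T} {τ₁ : Fin N₁ → C} {τ₂ : Fin N₂ → C} → τ₁ ∼[ suc T ] τ₂ →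
    ∀ u₁ → ∃ λ u₂ → τ₂ u₂ ≡ τ₁ u₁ × refine τ₁ ⁅ u₁ ⁆ ∼ʳ[ T ] refine τ₂ ⁅ u₂ ⁆
  refine-by-point {T = T} {τ₁} {τ₂} τ₁∼τ₂ u₁ =
    u₂ , τ₂u₂≡τ₁u₁ , refine-∼ τ₁ τ₂ ⁅ u₁ ⁆ ⁅ u₂ ⁆ (inj₁ ∘ same) outside
    where
    occurs : 1 ≤ ∣ τ₂ ⁻¹ τ₁ u₁ ∣
    occurs = ≈-≤ (counts τ₁∼τ₂ (τ₁ u₁)) (s≤s z≤n)
                 (count-pos (λ u → does (τ₁ u ≟ τ₁ u₁)) {u₁} (dec-true (τ₁ u₁ ≟ τ₁ u₁) refl))
    witness = count-witness (λ u → does (τ₂ u ≟ τ₁ u₁)) occurs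
    u₂ = proj₁ witness
    τ₂u₂≡τ₁u₁ : τ₂ u₂ ≡ τ₁ u₁
    τ₂u₂≡τ₁u₁ = dec-true⁻¹ (τ₂ u₂ ≟ τ₁ u₁) (proj₂ witness)
    same : ∀ c → ∣ τ₁ ⁻¹ c ∩ ⁅ u₁ ⁆ ∣ ≡ ∣ τ₂ ⁻¹ c ∩ ⁅ u₂ ⁆ ∣
    same c = begin
      ∣ τ₁ ⁻¹ c ∩ ⁅ u₁ ⁆ ∣                   ≡⟨ count-singleton _ u₁ ⟩
      (if does (τ₁ u₁ ≟ c) then 1 else 0)   ≡⟨ cong (λ e → if does (e ≟ c) then 1 else 0) τ₂u₂≡τ₁u₁ ⟨
      (if does (τ₂ u₂ ≟ c) then 1 else 0)   ≡⟨ count-singleton _ u₂ ⟨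
      ∣ τ₂ ⁻¹ c ∩ ⁅ u₂ ⁆ ∣                   ∎
      where open ≡-Reasoning
    at-most-one : ∀ c → ∣ τ₁ ⁻¹ c ∩ ⁅ u₁ ⁆ ∣ ≤ 1
    at-most-one c with does (τ₁ u₁ ≟ c) | count-singleton (λ u → does (τ₁ u ≟ c)) u₁
    ... | true  | e = ≤-reflexive e
    ... | false | e = ≤-trans (≤-reflexive e) z≤n
    outside : ∀ c →
      ∣ τ₁ ⁻¹ c ∣ ∸ ∣ τ₁ ⁻¹ c ∩ ⁅ u₁ ⁆ ∣ ≈[ T ] ∣ τ₂ ⁻¹ c ∣ ∸ ∣ τ₂ ⁻¹ c ∩ ⁅ u₂ ⁆ ∣
    outside c = subst (λ s → _ ≈[ T ] ∣ τ₂ ⁻¹ c ∣ ∸ s) (same c)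
                      (≈-∸ _ (≈-mono (+-monoˡ-≤ T (at-most-one c)) (counts τ₁∼τ₂ c)))

  refine-by-set : ∀ {N₁ N₂ T} {τ₁ : Fin N₁ → C} {τ₂ : Fin N₂ → C} → τ₁ ∼[ T + T ] τ₂ →
    ∀ X₁ → ∃ λ X₂ → refine τ₁ X₁ ∼ʳ[ T ] refine τ₂ X₂
  refine-by-set {T = T} {τ₁} {τ₂} τ₁∼τ₂ X₁ = X₂ , refine-∼ τ₁ τ₂ X₁ X₂ inside outside
    where
    split = λ c → ≈-split T (counts τ₁∼τ₂ c) (count-∧-≤ (λ u → does (τ₁ u ≟ c)) X₁)
    realised = realise τ₂ (proj₁ ∘ split) (proj₁ ∘ proj₂ ∘ split)
    X₂ = proj₁ realised
    inside : ∀ c → ∣ τ₁ ⁻¹ c ∩ X₁ ∣ ≈[ T ] ∣ τ₂ ⁻¹ c ∩ X₂ ∣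
    inside c = subst (_ ≈[ T ]_) (sym (proj₂ realised c)) (proj₁ (proj₂ (proj₂ (split c))))
    outside : ∀ c → ∣ τ₁ ⁻¹ c ∣ ∸ ∣ τ₁ ⁻¹ c ∩ X₁ ∣ ≈[ T ] ∣ τ₂ ⁻¹ c ∣ ∸ ∣ τ₂ ⁻¹ c ∩ X₂ ∣
    outside c =
      subst (λ s → _ ≈[ T ] ∣ τ₂ ⁻¹ c ∣ ∸ s) (sym (proj₂ realised c)) (proj₂ (proj₂ (proj₂ (split c))))

module StrictlyIncreasing {L} (d : Fin L → ℕ) (d-< : ∀ i j → i F.< j → d i < d j) where

  mono-≤ : ∀ {i j} → i F.≤ j → d i ≤ d j
  mono-≤ {i} {j} i≤j with m≤n⇒m<n∨m≡n i≤j
  ... | inj₁ i<j = <⇒≤ (d-< i j i<j)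
  ... | inj₂ i≡j = ≤-reflexive (cong d (toℕ-injective i≡j))

  reflect-≤ : ∀ {i j} → d i ≤ d j → i F.≤ j
  reflect-≤ {i} {j} di≤dj = ≮⇒≥ (λ j<i → <⇒≱ (d-< j i j<i) di≤dj)

  reflect-< : ∀ {i j} → d i < d j → i F.< j
  reflect-< di<dj = ≰⇒> (λ j≤i → <⇒≱ di<dj (mono-≤ j≤i))

  injective : ∀ {i j} → d i ≡ d j → i ≡ j
  injective di≡dj =
    toℕ-injective (≤-antisym (reflect-≤ (≤-reflexive di≡dj)) (reflect-≤ (≤-reflexive (sym di≡dj))))

record Ranking {g} (U : ODS g) (L : ℕ) : Set where
  field
    rank  : Elem U → Fin L
    sim⇔  : ∀ u v → Sim U u v ⇔ rank u ≡ rank v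
    prec⇔ : ∀ u v → Prec U u v ⇔ rank u F.< rank v
    succ⇔ : ∀ u v → Succ U u v ⇔ toℕ (rank v) ≡ suc (toℕ (rank u))

module Enumeration {g} (U : ODS g) {L} (d : Fin L → ℕ) (d-< : ∀ i j → i F.< j → d i < d j)
                   (cover : ∀ i → ∃ λ u → val U u ≡ d i) (onto : ∀ u → ∃ λ i → val U u ≡ d i) where
  open StrictlyIncreasing d d-<

  rank : Elem U → Fin L
  rank u = proj₁ (onto u)

  private
    to-d : ∀ (_R_ : ℕ → ℕ → Set) {u v} → val U u R val U v → d (rank u) R d (rank v)
    to-d _R_ {u} {v} = subst₂ _R_ (proj₂ (onto u)) (proj₂ (onto v))

    from-d : ∀ (_R_ : ℕ → ℕ → Set) {u v} → d (rank u) R d (rank v) → val U u R val U v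
    from-d _R_ {u} {v} = subst₂ _R_ (sym (proj₂ (onto u))) (sym (proj₂ (onto v)))

  rank≡⇔ : ∀ u i → rank u ≡ i ⇔ val U u ≡ d i
  rank≡⇔ u i = mk⇔ (λ e → trans (proj₂ (onto u)) (cong d e))
                   (λ e → injective (trans (sym (proj₂ (onto u))) e))

  succ→ : ∀ u v → Succ U u v → toℕ (rank v) ≡ suc (toℕ (rank u))
  succ→ u v (u<v , least) = ≤-antisym (subst (toℕ (rank v) ≤_) (toℕ-fromℕ< next) rv≤j) ru<rv
    where
    ru<rv = reflect-< (to-d _<_ u<v)
    next = ≤-<-trans ru<rv (toℕ<n (rank v))
    j = fromℕ< next
    w = proj₁ (cover j)
    u<w : val U u < val U w
    u<w = subst₂ _<_ (sym (proj₂ (onto u))) (sym (proj₂ (cover j)))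
                 (d-< (rank u) j (≤-reflexive (sym (toℕ-fromℕ< next))))
    rv≤j : toℕ (rank v) ≤ toℕ j
    rv≤j = reflect-≤ (subst₂ _≤_ (proj₂ (onto v)) (proj₂ (cover j)) (least w u<w))

  succ← : ∀ u v → toℕ (rank v) ≡ suc (toℕ (rank u)) → Succ U u v
  succ← u v rv≡1+ru = from-d _<_ (d-< (rank u) (rank v) (≤-reflexive (sym rv≡1+ru))) , least
    where
    least : ∀ w → val U u < val U w → val U v ≤ val U w
    least w u<w = from-d _≤_ (mono-≤ (subst (_≤ toℕ (rank w)) (sym rv≡1+ru) (reflect-< (to-d _<_ u<w))))

  ranked : Ranking U L
  ranked = record
    { rank  = rank
    ; sim⇔  = λ u v → mk⇔ (injective ∘ to-d _≡_) (from-d _≡_ ∘ cong d)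
    ; prec⇔ = λ u v → mk⇔ (reflect-< ∘ to-d _<_) (from-d _<_ ∘ d-< _ _)
    ; succ⇔ = λ u v → mk⇔ (succ→ u v) (succ← u v)
    }

k*2^[1+j]≡k*2^j+k*2^j : ∀ k j → k * 2 ^ suc j ≡ k * 2 ^ j + k * 2 ^ j
k*2^[1+j]≡k*2^j+k*2^j k j =
  trans (*-distribˡ-+ k (2 ^ j) _) (cong (λ x → k * 2 ^ j + k * x) (+-identityʳ (2 ^ j)))

module _ {g L : ℕ} where

  -- The most recently chosen variable is the outermost bit, so that choosing a
  -- variable is literally `refine` of the current profile.
  Colour : ℕ → Set
  Colour zero    = Fin L × Fin g
  Colour (suc k) = Colour k × Bool

  _≟ᶜ_ : ∀ {k} → DecidableEquality (Colour k)
  _≟ᶜ_ {zero}  = ≡-dec F._≟_ F._≟_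
  _≟ᶜ_ {suc k} = refine-≟ _≟ᶜ_

  open module Colours {k} = Colouring (_≟ᶜ_ {k}) public
  open module Refinements {k} = Refinement (_≟ᶜ_ {k}) using (refine; refine-by-point; refine-by-set)

  record Expansion (m n : ℕ) : Set where
    field
      structure : ODS g
      ranking   : Ranking structure L
      sets      : Fin m → Elem structure → Bool
      points    : Fin n → Elem structure
  open Expansion public
  open Ranking

  setProfile : ∀ {U : ODS g} {m} → Ranking U L → (Fin m → Elem U → Bool) → Elem U → Colour m
  setProfile {U} {zero} R σ u = rank R u , lab U u
  setProfile {m = suc m} R σ u = setProfile R (σ ∘ suc) u , σ zero u

  dropPoint : ∀ {m n} → Expansion m (suc n) → Expansion m n
  dropPoint E = record
    { structure = structure E ; ranking = ranking E ; sets = sets E ; points = points E ∘ suc }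

  profile : ∀ {m n} (E : Expansion m n) → Elem (structure E) → Colour (n + m)
  profile {n = zero}  E u = setProfile (ranking E) (sets E) u
  profile {n = suc n} E u = profile (dropPoint E) u , ⁅ points E zero ⁆ u

  _,ᵖ_ : ∀ {m n} (E : Expansion m n) → Elem (structure E) → Expansion m (suc n)
  E ,ᵖ u = record
    { structure = structure E ; ranking = ranking E ; sets = sets E ; points = u ∷ᵉ points E }

  _,ˢ_ : ∀ {m n} (E : Expansion m n) → (Elem (structure E) → Bool) → Expansion (suc m) n
  E ,ˢ X = record
    { structure = structure E ; ranking = ranking E ; sets = X ∷ᵉ sets E ; points = points E }

  profile⇒setProfile : ∀ {m n} (E₁ E₂ : Expansion m n) {u v} → profile E₁ u ≡ profile E₂ v →
    setProfile (ranking E₁) (sets E₁) u ≡ setProfile (ranking E₂) (sets E₂) v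
  profile⇒setProfile {n = zero}  E₁ E₂ e = e
  profile⇒setProfile {n = suc n} E₁ E₂ e =
    profile⇒setProfile (dropPoint E₁) (dropPoint E₂) (cong proj₁ e)

  setProfile⇒base : ∀ {U₁ U₂ : ODS g} {m} (R₁ : Ranking U₁ L) (R₂ : Ranking U₂ L) σ₁ σ₂ {u v} →
    setProfile {m = m} R₁ σ₁ u ≡ setProfile R₂ σ₂ v → (rank R₁ u , lab U₁ u) ≡ (rank R₂ v , lab U₂ v)
  setProfile⇒base {m = zero}  R₁ R₂ σ₁ σ₂ e = e
  setProfile⇒base {m = suc m} R₁ R₂ σ₁ σ₂ e =
    setProfile⇒base R₁ R₂ (σ₁ ∘ suc) (σ₂ ∘ suc) (cong proj₁ e)

  setProfile⇒sets : ∀ {U₁ U₂ : ODS g} {m} (R₁ : Ranking U₁ L) (R₂ : Ranking U₂ L) σ₁ σ₂ {u v} →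
    setProfile {m = m} R₁ σ₁ u ≡ setProfile R₂ σ₂ v → ∀ X → σ₁ X u ≡ σ₂ X v
  setProfile⇒sets R₁ R₂ σ₁ σ₂ e zero    = cong proj₂ e
  setProfile⇒sets R₁ R₂ σ₁ σ₂ e (suc X) =
    setProfile⇒sets R₁ R₂ (σ₁ ∘ suc) (σ₂ ∘ suc) (cong proj₁ e) X

  profile⇒points : ∀ {m n} (E₁ E₂ : Expansion m n) {u v} → profile E₁ u ≡ profile E₂ v →
    ∀ y → ⁅ points E₁ y ⁆ u ≡ ⁅ points E₂ y ⁆ v
  profile⇒points E₁ E₂ e zero    = cong proj₂ e
  profile⇒points E₁ E₂ e (suc y) =
    profile⇒points (dropPoint E₁) (dropPoint E₂) (cong proj₁ e) y

  Aligned : ∀ {m n} → Expansion m n → Expansion m n → Set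
  Aligned E₁ E₂ = ∀ x → profile E₁ (points E₁ x) ≡ profile E₂ (points E₂ x)

  module _ {m n} {E₁ E₂ : Expansion m n} (aligned : Aligned E₁ E₂) where

    private
      base≡ : ∀ x → (rank (ranking E₁) (points E₁ x) , lab (structure E₁) (points E₁ x))
                  ≡ (rank (ranking E₂) (points E₂ x) , lab (structure E₂) (points E₂ x))
      base≡ x = setProfile⇒base (ranking E₁) (ranking E₂) (sets E₁) (sets E₂)
                  (profile⇒setProfile E₁ E₂ (aligned x))

    aligned-rank : ∀ x → rank (ranking E₁) (points E₁ x) ≡ rank (ranking E₂) (points E₂ x)
    aligned-rank = cong proj₁ ∘ base≡

    aligned-label : ∀ x → lab (structure E₁) (points E₁ x) ≡ lab (structure E₂) (points E₂ x)
    aligned-label = cong proj₂ ∘ base≡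

    aligned-sets : ∀ x X → sets E₁ X (points E₁ x) ≡ sets E₂ X (points E₂ x)
    aligned-sets x = setProfile⇒sets (ranking E₁) (ranking E₂) (sets E₁) (sets E₂)
                       (profile⇒setProfile E₁ E₂ (aligned x))

    aligned-points : ∀ x y → ⁅ points E₁ y ⁆ (points E₁ x) ≡ ⁅ points E₂ y ⁆ (points E₂ x)
    aligned-points x = profile⇒points E₁ E₂ (aligned x)

    aligned-extend : ∀ {u₁ u₂} → profile E₁ u₁ ≡ profile E₂ u₂ → Aligned (E₁ ,ᵖ u₁) (E₂ ,ᵖ u₂)
    aligned-extend {u₁} {u₂} e zero    =
      cong₂ _,_ e (trans (dec-true (u₁ F.≟ u₁) refl) (sym (dec-true (u₂ F.≟ u₂) refl)))
    aligned-extend {u₁} {u₂} e (suc x) =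
      cong₂ _,_ (aligned x) (trans (⁅⁆-sym u₁ _) (trans (profile⇒points E₁ E₂ e x) (⁅⁆-sym _ u₂)))

  aligned-sym : ∀ {m n} {E₁ E₂ : Expansion m n} → Aligned E₁ E₂ → Aligned E₂ E₁
  aligned-sym aligned = sym ∘ aligned

  infix 4 _≃[_]_

  record _≃[_]_ {m n} (E₁ : Expansion m n) (T : ℕ) (E₂ : Expansion m n) : Set where
    constructor similar
    field
      profiles : _∼[_]_ {n + m} (profile E₁) T (profile E₂)
  open _≃[_]_

  ≃-sym : ∀ {m n T} {E₁ E₂ : Expansion m n} → E₁ ≃[ T ] E₂ → E₂ ≃[ T ] E₁
  ≃-sym (similar E) = similar (∼-sym E)

  Sat : ∀ {m n} → Expansion m n → Fo g m n → Set
  Sat E = SatFo (structure E) (sets E) (points E)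

  fo-transfer : ∀ {m n T} (E₁ E₂ : Expansion m n) (φ : Fo g m n) → qr φ ≤ T →
    E₁ ≃[ T ] E₂ → Aligned E₁ E₂ → Sat E₁ φ → Sat E₂ φ
  fo-transfer E₁ E₂ (lbl a x) _ _ A s = trans (sym (aligned-label A x)) s
  fo-transfer E₁ E₂ (eq x y) _ _ A s =
    dec-true⁻¹ (points E₂ x F.≟ points E₂ y)
      (trans (sym (aligned-points A y x)) (dec-true (points E₁ x F.≟ points E₁ y) s))
  fo-transfer E₁ E₂ (sim x y) _ _ A s =
    from (sim⇔ (ranking E₂) _ _)
      (subst₂ _≡_ (aligned-rank A x) (aligned-rank A y) (to (sim⇔ (ranking E₁) _ _) s))
  fo-transfer E₁ E₂ (prec x y) _ _ A s =
    from (prec⇔ (ranking E₂) _ _)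
      (subst₂ F._<_ (aligned-rank A x) (aligned-rank A y) (to (prec⇔ (ranking E₁) _ _) s))
  fo-transfer E₁ E₂ (succ x y) _ _ A s =
    from (succ⇔ (ranking E₂) _ _)
      (subst₂ (λ i j → toℕ j ≡ suc (toℕ i)) (aligned-rank A x) (aligned-rank A y)
              (to (succ⇔ (ranking E₁) _ _) s))
  fo-transfer E₁ E₂ (mem x X) _ _ A s = trans (sym (aligned-sets A x X)) s
  fo-transfer E₁ E₂ (neg φ) q E A s = s ∘ fo-transfer E₂ E₁ φ q (≃-sym E) (aligned-sym A)
  fo-transfer E₁ E₂ (and φ ψ) q E A (s , t) =
    fo-transfer E₁ E₂ φ (m⊔n≤o⇒m≤o _ _ q) E A s , fo-transfer E₁ E₂ ψ (m⊔n≤o⇒n≤o _ _ q) E A t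
  fo-transfer E₁ E₂ (or φ ψ) q E A (inj₁ s) = inj₁ (fo-transfer E₁ E₂ φ (m⊔n≤o⇒m≤o _ _ q) E A s)
  fo-transfer E₁ E₂ (or φ ψ) q E A (inj₂ t) = inj₂ (fo-transfer E₁ E₂ ψ (m⊔n≤o⇒n≤o _ _ q) E A t)
  fo-transfer {m} {n} E₁ E₂ (ex φ) (s≤s q) E A (u₁ , s) =
    let u₂ , e , E′ = refine-by-point {n + m} (profiles E) u₁
    in u₂ , fo-transfer (E₁ ,ᵖ u₁) (E₂ ,ᵖ u₂) φ q (similar E′) (aligned-extend A (sym e)) s
  fo-transfer {m} {n} E₁ E₂ (all φ) (s≤s q) E A s u₂ =
    let u₁ , e , E′ = refine-by-point {n + m} (profiles (≃-sym E)) u₂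
    in fo-transfer (E₁ ,ᵖ u₁) (E₂ ,ᵖ u₂) φ q (≃-sym (similar E′)) (aligned-extend A e) (s u₁)

  mso-transfer : ∀ {m} k j (E₁ E₂ : Expansion m 0) (φ : MSO g m) → MSO-qr φ ≤ j → FO-qr φ ≤ k →
    E₁ ≃[ k * 2 ^ j ] E₂ → SatMSO (structure E₁) (sets E₁) φ → SatMSO (structure E₂) (sets E₂) φ
  -- SatMSO evaluates the body under the point assignment λ (), which is not
  -- definitionally points E.
  mso-transfer k j E₁ E₂ (body ψ) _ f E s =
    fo-transfer (record E₁ { points = λ () }) (record E₂ { points = λ () }) ψ
                (≤-trans f (m≤m*n k (2 ^ j) {{m^n≢0 2 j}})) (similar (profiles E)) (λ ()) s
  mso-transfer {m} k (suc j) E₁ E₂ (exSO φ) (s≤s q) f E (X₁ , s) =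
    let X₂ , E′ = refine-by-set {m} (profiles (subst (E₁ ≃[_] E₂) (k*2^[1+j]≡k*2^j+k*2^j k j) E)) X₁
    in X₂ , mso-transfer k j (E₁ ,ˢ X₁) (E₂ ,ˢ X₂) φ q f (similar E′) s
  mso-transfer {m} k (suc j) E₁ E₂ (allSO φ) (s≤s q) f E s X₂ =
    let X₁ , E′ = refine-by-set {m}
                    (profiles (subst (E₂ ≃[_] E₁) (k*2^[1+j]≡k*2^j+k*2^j k j) (≃-sym E))) X₂
    in mso-transfer k j (E₁ ,ˢ X₁) (E₂ ,ˢ X₂) φ q f (≃-sym (similar E′)) (s X₁)

  initial : ∀ {U : ODS g} → Ranking U L → Expansion 0 0
  initial {U} R = record { structure = U ; ranking = R ; sets = λ () ; points = λ () }

length-filter-tabulate : ∀ {A : Set} {P : A → Set} (P? : ∀ x → Dec (P x)) {n} (f : Fin n → A) →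
  length (filter P? (tabulate f)) ≡ count (λ u → does (P? (f u)))
length-filter-tabulate P? {zero}  f = refl
length-filter-tabulate P? {suc n} f with does (P? (f zero))
... | true  = cong suc (length-filter-tabulate P? (f ∘ suc))
... | false = length-filter-tabulate P? (f ∘ suc)

module Representation {g K} {U : ODS g} (w : List (Letter g K)) (R : IsRep K U w) where

  d : Fin (length w) → ℕ
  d = proj₁ R

  open Enumeration U d (proj₁ (proj₂ R)) (proj₁ (proj₂ (proj₂ R))) (proj₁ (proj₂ (proj₂ (proj₂ R))))
    public using (rank; ranked; rank≡⇔)

  private
    module LetterAt (i : Fin (length w)) where
      f = proj₂ (List.lookup w i)
      conditions     = proj₂ (proj₂ (proj₂ (proj₂ R))) i
      occurs⇔        = proj₁ conditions
      characteristic = proj₁ (proj₂ conditions)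
      exact          = proj₁ (proj₂ (proj₂ conditions))
      many           = proj₂ (proj₂ (proj₂ conditions))

  countLV≡count : ∀ a x → countLV U a x ≡ count (λ u → does ((lab U u F.≟ a) ×-dec (val U u N.≟ x)))
  countLV≡count a x = length-filter-tabulate (λ u → (lab U u F.≟ a) ×-dec (val U u N.≟ x)) id

  countLV-≈-letter : ∀ i a → countLV U a (d i) ≈[ K ] toℕ (Vec.lookup (proj₂ (List.lookup w i)) a)
  countLV-≈-letter i a = ≈-truncation (s≤s⁻¹ (toℕ<n (Vec.lookup f a))) (many a) (exact a) empty
    where
    open LetterAt i
    empty : toℕ (Vec.lookup f a) ≡ 0 → countLV U a (d i) ≡ 0
    empty f≡0 = trans (countLV≡count a (d i)) (count-none λ u →
      dec-false ((lab U u F.≟ a) ×-dec (val U u N.≟ d i)) λ located →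
        n≮0 (subst (1 ≤_) f≡0 (proj₁ (proj₁ (characteristic a) (from (occurs⇔ a) (u , located))))))

  initial-count : ∀ i a → ∣_⁻¹_∣ {k = 0} (profile (initial ranked)) (i , a) ≡ countLV U a (d i)
  initial-count i a = sym (trans (countLV≡count a (d i)) (count-cong λ u →
    does-⇔ (located⇔ u) ((lab U u F.≟ a) ×-dec (val U u N.≟ d i))
                        (_≟ᶜ_ {k = 0} (profile (initial ranked) u) (i , a))))
    where
    located⇔ : ∀ u → (lab U u ≡ a × val U u ≡ d i) ⇔ ((rank u , lab U u) ≡ (i , a))
    located⇔ u = mk⇔ (λ (l , v) → cong₂ _,_ (from (rank≡⇔ u i) v) l)
                     (λ e → proj₂ (,-injective e) , to (rank≡⇔ u i) (proj₁ (,-injective e)))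

initial-≃ : ∀ {g K} {U₁ U₂ : ODS g} (w : List (Letter g K)) (R₁ : IsRep K U₁ w) (R₂ : IsRep K U₂ w) →
  initial (Representation.ranked w R₁) ≃[ K ] initial (Representation.ranked w R₂)
initial-≃ {K = K} w R₁ R₂ = similar (by-counts {k = 0} λ (i , a) →
  subst₂ _≈[ K ]_ (sym (Rep₁.initial-count i a)) (sym (Rep₂.initial-count i a))
         (≈-trans (Rep₁.countLV-≈-letter i a) (≈-sym (Rep₂.countLV-≈-letter i a))))
  where
  module Rep₁ = Representation w R₁
  module Rep₂ = Representation w R₂

lemma4p2 : ∀ {g : ℕ} (k s : ℕ) (U₁ U₂ : ODS g)
    → (∃ λ w → IsRep (k * 2 ^ s) U₁ w × IsRep (k * 2 ^ s) U₂ w)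
    → (φ : Sentence g) → MSO-qr φ ≤ s → FO-qr φ ≤ k
    → (U₁ ⊨ φ) ⇔ (U₂ ⊨ φ)
lemma4p2 k s U₁ U₂ (w , R₁ , R₂) φ mso-qr≤s fo-qr≤k =
  mk⇔ (mso-transfer k s E₁ E₂ φ mso-qr≤s fo-qr≤k (initial-≃ w R₁ R₂))
      (mso-transfer k s E₂ E₁ φ mso-qr≤s fo-qr≤k (≃-sym (initial-≃ w R₁ R₂)))
  where
  E₁ = initial (Representation.ranked w R₁)
  E₂ = initial (Representation.ranked w R₂)
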